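{- $\tilde{A}_0=\hat{I}\cap\mathrm{RGF}$, where $\hat{I}=\bigcup_{d\ge0}\hat{A}_d$.
   Context: All sequences are finite words $\alpha=a_1\ldots a_n$ ($n\ge0$) of positive integers. For an integer $d\ge 0$, an index $i\in[n]$ is a $d$-ascent of $\alpha$ if $i=1$, or $i\ge 2$ and $a_i>a_{i-1}-d$; $\mathrm{asc}_d\alpha$ is the number of $d$-ascents. $\alpha$ is a $d$-ascent sequence if $a_i\le1+\mathrm{asc}_d(a_1\ldots a_{i-1})$ for all $i\in[n]$; $A_d$ is the set of these. For a word $\alpha$ and index $j$, $M(\alpha,j)$ adds $1$ to every $a_i$ with $i<j$ and $a_i\ge a_j$; $M(\alpha,j_1,\dots,j_k)=M(M(\alpha,j_1,\dots,j_{k-1}),j_k)$; $\mathrm{hat}_d(\alpha)=M(\alpha,j_1,\dots,j_k)$ with $j_1<\dots<j_k$ the $d$-ascents of $\alpha$. $\hat{A}_d=\{\mathrm{hat}_d(\alpha):\alpha\in A_d\}$ (modified $d$-ascent sequences); $\hat I$ is the set of modified inversion sequences. $\tilde{A}_0=\{\alpha\in A_0:\mathrm{hat}_0(\alpha)=\alpha\}$. $\mathrm{RGF}$ is the set of words with $a_1=1$ and $a_{i+1}\le1+\max(a_1\ldots a_i)$ for each $i\in[n-1]$ (including the empty word). -}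

module Defs where

open import Data.Nat using (ℕ; zero; suc; _+_; _≤_; _<_; _⊔_)
open import Data.Nat.Properties using (_≤?_; _<?_)
open import Data.Bool using (Bool; true; false; if_then_else_)
open import Data.List using (List; []; _∷_; length; take; foldl; foldr; lookup)
open import Data.List.Relation.Unary.All using (All)
open import Data.Fin using (Fin; toℕ)
open import Data.Product using (Σ; _×_; ∃-syntax)
open import Data.Unit using (⊤)
open import Relation.Binary.PropositionalEquality using (_≡_)
open import Relation.Nullary.Decidable using (does)

Word : Set
Word = List ℕ

Positive : Word → Set
Positive = All (1 ≤_)

-- Index i ≥ 2 is a d-ascent iff a_i > a_{i-1} - d, i.e. a_i + d > a_{i-1}.
isAscStep : ℕ → ℕ → ℕ → Bool
isAscStep d prev x = does (prev <? x + d)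

ascFrom : ℕ → ℕ → Word → ℕ
ascFrom d prev [] = 0
ascFrom d prev (x ∷ xs) = (if isAscStep d prev x then 1 else 0) + ascFrom d x xs

-- asc_d α (index 1 is always a d-ascent)
asc : ℕ → Word → ℕ
asc d [] = 0
asc d (x ∷ xs) = suc (ascFrom d x xs)

-- d-ascent sequences: a_i ≤ 1 + asc_d(a_1 … a_{i-1}) for all i
-- (position i is the 0-based Fin index, so the prefix is take i α)
IsAscSeq : ℕ → Word → Set
IsAscSeq d α = Positive α × ((i : Fin (length α)) → lookup α i ≤ suc (asc d (take (toℕ i) α)))

-- 0-based positions of d-ascents, in increasing order; `pos` is the position of the current letter
ascIdxFrom : ℕ → ℕ → ℕ → Word → List ℕ
ascIdxFrom d pos prev [] = []
ascIdxFrom d pos prev (x ∷ xs) =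
  if isAscStep d prev x then pos ∷ ascIdxFrom d (suc pos) x xs else ascIdxFrom d (suc pos) x xs

ascents : ℕ → Word → List ℕ
ascents d [] = []
ascents d (x ∷ xs) = 0 ∷ ascIdxFrom d 1 x xs

bump : ℕ → ℕ → Word → Word
bump v zero xs = xs
bump v (suc k) [] = []
bump v (suc k) (x ∷ xs) = (if does (v ≤? x) then suc x else x) ∷ bump v k xs

-- M(α, j) with j a 0-based position (the paper's index j+1); identity if j is out of range
dropW : ℕ → Word → Word
dropW zero xs = xs
dropW (suc n) [] = []
dropW (suc n) (x ∷ xs) = dropW n xs

M : Word → ℕ → Word
M α j with dropW j α
... | [] = α
... | v ∷ _ = bump v j α

hat : ℕ → Word → Word
hat d α = foldl M α (ascents d α)

InAhat : ℕ → Word → Set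
InAhat d β = ∃[ α ] (IsAscSeq d α × hat d α ≡ β)

InIhat : Word → Set
InIhat β = ∃[ d ] InAhat d β

InAtilde0 : Word → Set
InAtilde0 α = IsAscSeq 0 α × hat 0 α ≡ α

maxW : Word → ℕ
maxW = foldr _⊔_ 0

IsRGF : Word → Set
IsRGF [] = ⊤
IsRGF (x ∷ xs) = Positive (x ∷ xs) × x ≡ 1 ×
  ((i : Fin (length (x ∷ xs))) → lookup (x ∷ xs) i ≤ suc (maxW (take (toℕ i) (x ∷ xs))))

-- hat_d applies M at the d-ascents of α, and M only increases letters, so hat_d α = α exactly
-- when every d-ascent of α is a strict left-to-right maximum (a record). For α ∈ Ã₀ every
-- 0-ascent therefore raises the running maximum, so asc₀ of a prefix is at most its maximum
-- and the ascent-sequence bound becomes the RGF bound. Conversely, in β = hat_d α a rise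
-- β_k < β_{k+1} can only occur at a d-ascent of α, because M preserves weak descents elsewhere;
-- M at that position makes β_{k+1} differ from all earlier letters, and the later M's, acting
-- injectively on earlier letters, keep it so. In an RGF all smaller positive values have
-- already occurred, so such a fresh letter exceeds the prefix maximum: every 0-ascent of β is
-- a record and hat₀ β = β. Finally an RGF is a 0-ascent sequence since each new maximum is an ascent.

module Submission where

open import Defs
open import Data.Bool using (true; false; if_then_else_)
open import Data.Empty using (⊥-elim)
open import Data.Fin using (Fin; toℕ; fromℕ<)
open import Data.Fin.Properties using (toℕ<n; toℕ-fromℕ<)
open import Data.List using ([]; _∷_; length; take; foldl; lookup)
open import Data.List.Membership.Propositional using (_∈_; _∉_)
open import Data.List.Relation.Binary.Pointwise using (Pointwise; []; _∷_; Pointwise-≡⇒≡)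
import Data.List.Relation.Binary.Pointwise as Pointwise
open import Data.List.Relation.Unary.All using (All; []; _∷_)
import Data.List.Relation.Unary.All as All
open import Data.List.Relation.Unary.AllPairs using (AllPairs; []; _∷_)
open import Data.List.Relation.Unary.Any using (here; there)
open import Data.Nat using (ℕ; zero; suc; _+_; _≤_; _<_; _≤ᵇ_; _⊔_; z≤n; s≤s; s≤s⁻¹)
open import Data.Nat.Properties
open import Data.Product using (_×_; _,_; proj₁; proj₂; ∃-syntax)
open import Data.Sum using (inj₁; inj₂)
open import Data.Unit using (⊤; tt)
open import Function.Base using (_∘_)
open import Function.Bundles using (_⇔_; mk⇔; Equivalence)
open import Relation.Binary.PropositionalEquality
open import Relation.Binary.Definitions using (tri<; tri≈; tri>)
open import Relation.Nullary using (¬_; yes; no)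
open import Relation.Nullary.Reflects using (Reflects; ofʸ; ofⁿ)

open Equivalence using (to; from)

-- The letter at 0-based position i; the junk value 0 beyond the end is never used,
-- since every statement about `nth w i` carries i < length w.
nth : Word → ℕ → ℕ
nth []       _       = 0
nth (x ∷ xs) zero    = x
nth (x ∷ xs) (suc i) = nth xs i

IsRecord : Word → ℕ → Set
IsRecord w j = ∀ {i} → i < j → nth w i < nth w j

IsFresh : Word → ℕ → Set
IsFresh w j = ∀ {i} → i < j → nth w i ≢ nth w j

IsAscentAt : ℕ → Word → ℕ → Set
IsAscentAt d w zero    = ⊤
IsAscentAt d w (suc k) = nth w k < nth w (suc k) + d

Bounded : Word → (ℕ → ℕ) → Set
Bounded w f = ∀ {i} → i < length w → nth w i ≤ f i

Positive-nth : ∀ {w i} → Positive w → i < length w → 1 ≤ nth w i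
Positive-nth {i = zero}  (p ∷ _)  _         = p
Positive-nth {i = suc i} (_ ∷ ps) (s≤s i<l) = Positive-nth ps i<l

-- Bumping letters and the operation M

bumpLetter : ℕ → ℕ → ℕ
bumpLetter v x = if v ≤ᵇ x then suc x else x

bumpLetter-≥ : ∀ {v x} → v ≤ x → bumpLetter v x ≡ suc x
bumpLetter-≥ {v} {x} v≤x with v ≤ᵇ x | ≤ᵇ-reflects-≤ v x
... | true  | _       = refl
... | false | ofⁿ v≰x = ⊥-elim (v≰x v≤x)

bumpLetter-< : ∀ {v x} → x < v → bumpLetter v x ≡ x
bumpLetter-< {v} {x} x<v with v ≤ᵇ x | ≤ᵇ-reflects-≤ v x
... | true  | ofʸ v≤x = ⊥-elim (<⇒≱ x<v v≤x)
... | false | _       = refl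

bumpLetter-mono : ∀ v {x y} → x ≤ y → bumpLetter v x ≤ bumpLetter v y
bumpLetter-mono v {x} {y} x≤y with v ≤? x | v ≤? y
... | yes v≤x | yes v≤y rewrite bumpLetter-≥ v≤x | bumpLetter-≥ v≤y = s≤s x≤y
... | yes v≤x | no  v≰y = ⊥-elim (v≰y (≤-trans v≤x x≤y))
... | no  v≰x | yes v≤y rewrite bumpLetter-< (≰⇒> v≰x) | bumpLetter-≥ v≤y = m≤n⇒m≤1+n x≤y
... | no  v≰x | no  v≰y rewrite bumpLetter-< (≰⇒> v≰x) | bumpLetter-< (≰⇒> v≰y) = x≤y

bumpLetter-inflationary : ∀ v x → x ≤ bumpLetter v x
bumpLetter-inflationary v x with v ≤? x
... | yes v≤x rewrite bumpLetter-≥ v≤x = n≤1+n x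
... | no  v≰x rewrite bumpLetter-< (≰⇒> v≰x) = ≤-refl

bumpLetter-injective : ∀ v {x y} → bumpLetter v x ≡ bumpLetter v y → x ≡ y
bumpLetter-injective v {x} {y} eq with v ≤? x | v ≤? y
... | yes v≤x | yes v≤y rewrite bumpLetter-≥ v≤x | bumpLetter-≥ v≤y = suc-injective eq
... | yes v≤x | no  v≰y rewrite bumpLetter-≥ v≤x | bumpLetter-< (≰⇒> v≰y) =
  ⊥-elim (v≰y (subst (v ≤_) eq (m≤n⇒m≤1+n v≤x)))
... | no  v≰x | yes v≤y rewrite bumpLetter-< (≰⇒> v≰x) | bumpLetter-≥ v≤y =
  ⊥-elim (v≰x (subst (v ≤_) (sym eq) (m≤n⇒m≤1+n v≤y)))
... | no  v≰x | no  v≰y rewrite bumpLetter-< (≰⇒> v≰x) | bumpLetter-< (≰⇒> v≰y) = eq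

length-bump : ∀ v k w → length (bump v k w) ≡ length w
length-bump v zero    w       = refl
length-bump v (suc k) []      = refl
length-bump v (suc k) (x ∷ w) = cong suc (length-bump v k w)

nth-bump-< : ∀ v k w {i} → i < k → i < length w → nth (bump v k w) i ≡ bumpLetter v (nth w i)
nth-bump-< v (suc k) (x ∷ w) {zero}  _         _         = refl
nth-bump-< v (suc k) (x ∷ w) {suc i} (s≤s i<k) (s≤s i<l) = nth-bump-< v k w i<k i<l

nth-bump-≥ : ∀ v k w {i} → k ≤ i → nth (bump v k w) i ≡ nth w i
nth-bump-≥ v zero    w       _         = refl
nth-bump-≥ v (suc k) []      _         = refl
nth-bump-≥ v (suc k) (x ∷ w) (s≤s k≤i) = nth-bump-≥ v k w k≤i

bump-inflationary : ∀ v k w → Pointwise _≤_ w (bump v k w)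
bump-inflationary v zero    w       = Pointwise.refl ≤-refl
bump-inflationary v (suc k) []      = []
bump-inflationary v (suc k) (x ∷ w) = bumpLetter-inflationary v x ∷ bump-inflationary v k w

bump-id : ∀ v k w → (∀ {i} → i < k → i < length w → nth w i < v) → bump v k w ≡ w
bump-id v zero    w       small = refl
bump-id v (suc k) []      small = refl
bump-id v (suc k) (x ∷ w) small =
  cong₂ _∷_ (bumpLetter-< (small (s≤s z≤n) (s≤s z≤n)))
            (bump-id v k w (λ i<k i<l → small (s≤s i<k) (s≤s i<l)))

dropW-< : ∀ j w → j < length w → ∃[ t ] dropW j w ≡ nth w j ∷ t
dropW-< zero    (x ∷ w) _         = w , refl
dropW-< (suc j) (x ∷ w) (s≤s j<l) = dropW-< j w j<l

dropW-≥ : ∀ j w → length w ≤ j → dropW j w ≡ []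
dropW-≥ zero    []      _         = refl
dropW-≥ (suc j) []      _         = refl
dropW-≥ (suc j) (x ∷ w) (s≤s l≤j) = dropW-≥ j w l≤j

M-< : ∀ w j → j < length w → M w j ≡ bump (nth w j) j w
M-< w j j<l with dropW j w | dropW-< j w j<l
... | .(nth w j ∷ t) | t , refl = refl

M-≥ : ∀ w j → length w ≤ j → M w j ≡ w
M-≥ w j l≤j with dropW j w | dropW-≥ j w l≤j
... | .[] | refl = refl

length-M : ∀ w j → length (M w j) ≡ length w
length-M w j with j <? length w
... | yes j<l rewrite M-< w j j<l = length-bump _ j w
... | no  j≮l rewrite M-≥ w j (≮⇒≥ j≮l) = refl

length-foldl-M : ∀ w js → length (foldl M w js) ≡ length w
length-foldl-M w []       = refl
length-foldl-M w (j ∷ js) = trans (length-foldl-M (M w j) js) (length-M w j)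

M-inflationary : ∀ w j → Pointwise _≤_ w (M w j)
M-inflationary w j with j <? length w
... | yes j<l rewrite M-< w j j<l = bump-inflationary _ j w
... | no  j≮l rewrite M-≥ w j (≮⇒≥ j≮l) = Pointwise.refl ≤-refl

foldl-M-inflationary : ∀ w js → Pointwise _≤_ w (foldl M w js)
foldl-M-inflationary w []       = Pointwise.refl ≤-refl
foldl-M-inflationary w (j ∷ js) =
  Pointwise.transitive ≤-trans (M-inflationary w j) (foldl-M-inflationary (M w j) js)

M-fixed⇔record : ∀ w j → j < length w → M w j ≡ w ⇔ IsRecord w j
M-fixed⇔record w j j<l = mk⇔ fixed⇒record record⇒fixed
  where
  fixed⇒record : M w j ≡ w → IsRecord w j
  fixed⇒record fixed {i} i<j with nth w j ≤? nth w i
  ... | no  wj≰wi = ≰⇒> wj≰wi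
  ... | yes wj≤wi = ⊥-elim (1+n≢n wi+1≡wi)
    where
    open ≡-Reasoning
    wi+1≡wi : suc (nth w i) ≡ nth w i
    wi+1≡wi = begin
      suc (nth w i)                  ≡⟨ bumpLetter-≥ wj≤wi ⟨
      bumpLetter (nth w j) (nth w i) ≡⟨ nth-bump-< (nth w j) j w i<j (<-trans i<j j<l) ⟨
      nth (bump (nth w j) j w) i     ≡⟨ cong (λ u → nth u i) (M-< w j j<l) ⟨
      nth (M w j) i                  ≡⟨ cong (λ u → nth u i) fixed ⟩
      nth w i                        ∎

  record⇒fixed : IsRecord w j → M w j ≡ w
  record⇒fixed rec = trans (M-< w j j<l) (bump-id _ j w (λ i<j _ → rec i<j))

-- M only increases letters, so a composite of M's fixes w only if its first factor does.
foldl-M-fixed⇒M-fixed : ∀ w r js → foldl M (M w r) js ≡ w → M w r ≡ w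
foldl-M-fixed⇒M-fixed w r js fixed = Pointwise-≡⇒≡ (Pointwise.antisymmetric ≤-antisym
  (subst (Pointwise _≤_ (M w r)) fixed (foldl-M-inflationary (M w r) js))
  (M-inflationary w r))

foldl-M-fixed⇔records : ∀ w js →
  foldl M w js ≡ w ⇔ (∀ {j} → j ∈ js → j < length w → IsRecord w j)
foldl-M-fixed⇔records w js = mk⇔ (fixed⇒records js) (records⇒fixed js)
  where
  fixed⇒records : ∀ js → foldl M w js ≡ w → ∀ {j} → j ∈ js → j < length w → IsRecord w j
  fixed⇒records (r ∷ js) fixed (here refl) j<l =
    M-fixed⇔record w r j<l .to (foldl-M-fixed⇒M-fixed w r js fixed)
  fixed⇒records (r ∷ js) fixed (there j∈js) j<l =
    fixed⇒records js (subst (λ u → foldl M u js ≡ w) (foldl-M-fixed⇒M-fixed w r js fixed) fixed) j∈js j<l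

  records⇒fixed : ∀ js → (∀ {j} → j ∈ js → j < length w → IsRecord w j) → foldl M w js ≡ w
  records⇒fixed []       _    = refl
  records⇒fixed (r ∷ js) recs = trans (cong (λ u → foldl M u js) Mr-fixed) (records⇒fixed js (recs ∘ there))
    where
    Mr-fixed : M w r ≡ w
    Mr-fixed with r <? length w
    ... | yes r<l = M-fixed⇔record w r r<l .from (recs (here refl) r<l)
    ... | no  r≮l = M-≥ w r (≮⇒≥ r≮l)

M-preserves-descent : ∀ w r k → suc k ≢ r → suc k < length w →
  nth w (suc k) ≤ nth w k → nth (M w r) (suc k) ≤ nth (M w r) k
M-preserves-descent w r k k+1≢r k+1<l desc with r <? length w
... | no  r≮l rewrite M-≥ w r (≮⇒≥ r≮l) = desc
... | yes r<l rewrite M-< w r r<l with <-cmp r (suc k)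
...   | tri≈ _ r≡k+1 _ = ⊥-elim (k+1≢r (sym r≡k+1))
...   | tri< r<k+1 _ _ rewrite nth-bump-≥ (nth w r) r w (<⇒≤ r<k+1)
                             | nth-bump-≥ (nth w r) r w (s≤s⁻¹ r<k+1) = desc
...   | tri> _ _ k+1<r rewrite nth-bump-< (nth w r) r w k+1<r k+1<l
                             | nth-bump-< (nth w r) r w (<-trans (n<1+n k) k+1<r) (<-trans (n<1+n k) k+1<l)
                             = bumpLetter-mono (nth w r) desc

foldl-M-preserves-descent : ∀ w js k → suc k < length w → suc k ∉ js →
  nth w (suc k) ≤ nth w k → nth (foldl M w js) (suc k) ≤ nth (foldl M w js) k
foldl-M-preserves-descent w []       k _     _     desc = desc
foldl-M-preserves-descent w (r ∷ js) k k+1<l k+1∉js desc =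
  foldl-M-preserves-descent (M w r) js k (subst (suc k <_) (sym (length-M w r)) k+1<l) (k+1∉js ∘ there)
    (M-preserves-descent w r k (k+1∉js ∘ here) k+1<l desc)

M-preserves-≢ : ∀ w r {i j} → i < j → j < r → j < length w →
  nth w i ≢ nth w j → nth (M w r) i ≢ nth (M w r) j
M-preserves-≢ w r {i} {j} i<j j<r j<l wi≢wj with r <? length w
... | no  r≮l rewrite M-≥ w r (≮⇒≥ r≮l) = wi≢wj
... | yes r<l rewrite M-< w r r<l
                    | nth-bump-< (nth w r) r w (<-trans i<j j<r) (<-trans i<j j<l)
                    | nth-bump-< (nth w r) r w j<r j<l = wi≢wj ∘ bumpLetter-injective (nth w r)

foldl-M-preserves-fresh : ∀ w rs {j} → All (j <_) rs → j < length w →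
  IsFresh w j → IsFresh (foldl M w rs) j
foldl-M-preserves-fresh w []       _            _   fresh = fresh
foldl-M-preserves-fresh w (r ∷ rs) (j<r ∷ j<rs) j<l fresh =
  foldl-M-preserves-fresh (M w r) rs j<rs (subst (_ <_) (sym (length-M w r)) j<l)
    (λ i<j → M-preserves-≢ w r i<j j<r j<l (fresh i<j))

M-fresh : ∀ w j → j < length w → IsFresh (M w j) j
M-fresh w j j<l {i} i<j
  rewrite M-< w j j<l
        | nth-bump-< (nth w j) j w i<j (<-trans i<j j<l)
        | nth-bump-≥ (nth w j) j w ≤-refl with nth w j ≤? nth w i
... | yes wj≤wi rewrite bumpLetter-≥ wj≤wi = λ eq → <⇒≱ (s≤s wj≤wi) (≤-reflexive eq)
... | no  wj≰wi rewrite bumpLetter-< (≰⇒> wj≰wi) = λ eq → wj≰wi (≤-reflexive (sym eq))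

foldl-M-fresh : ∀ w js {j} → AllPairs _<_ js → j ∈ js → j < length w → IsFresh (foldl M w js) j
foldl-M-fresh w (r ∷ rs) (r<rs ∷ _) (here refl) r<l =
  foldl-M-preserves-fresh (M w r) rs r<rs (subst (r <_) (sym (length-M w r)) r<l) (M-fresh w r r<l)
foldl-M-fresh w (r ∷ rs) (_ ∷ sorted) (there j∈rs) j<l =
  foldl-M-fresh (M w r) rs sorted j∈rs (subst (_ <_) (sym (length-M w r)) j<l)

-- Ascents

isAscStep-reflects : ∀ d prev x → Reflects (prev < x + d) (isAscStep d prev x)
isAscStep-reflects d prev x = <ᵇ-reflects-< prev (x + d)

ascIdxFrom-lowerBound : ∀ d pos prev xs → All (pos ≤_) (ascIdxFrom d pos prev xs)
ascIdxFrom-lowerBound d pos prev [] = []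
ascIdxFrom-lowerBound d pos prev (x ∷ xs) with isAscStep d prev x | isAscStep-reflects d prev x
... | true  | _ = ≤-refl ∷ All.map (≤-trans (n≤1+n pos)) (ascIdxFrom-lowerBound d (suc pos) x xs)
... | false | _ = All.map (≤-trans (n≤1+n pos)) (ascIdxFrom-lowerBound d (suc pos) x xs)

ascIdxFrom-sorted : ∀ d pos prev xs → AllPairs _<_ (ascIdxFrom d pos prev xs)
ascIdxFrom-sorted d pos prev [] = []
ascIdxFrom-sorted d pos prev (x ∷ xs) with isAscStep d prev x | isAscStep-reflects d prev x
... | true  | _ = ascIdxFrom-lowerBound d (suc pos) x xs ∷ ascIdxFrom-sorted d (suc pos) x xs
... | false | _ = ascIdxFrom-sorted d (suc pos) x xs

ascIdxFrom-sound : ∀ d pos prev xs {j} → j ∈ ascIdxFrom d pos prev xs →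
  ∃[ k ] j ≡ pos + k × k < length xs × nth (prev ∷ xs) k < nth xs k + d
ascIdxFrom-sound d pos prev (x ∷ xs) j∈ with isAscStep d prev x | isAscStep-reflects d prev x
... | true  | ofʸ asc with j∈
...   | here refl = 0 , sym (+-identityʳ pos) , s≤s z≤n , asc
...   | there j∈′ with ascIdxFrom-sound d (suc pos) x xs j∈′
...     | k , refl , k<l , a = suc k , sym (+-suc pos k) , s≤s k<l , a
ascIdxFrom-sound d pos prev (x ∷ xs) j∈ | false | _ with ascIdxFrom-sound d (suc pos) x xs j∈
...   | k , refl , k<l , a = suc k , sym (+-suc pos k) , s≤s k<l , a

ascIdxFrom-complete : ∀ d pos prev xs {k} → k < length xs → nth (prev ∷ xs) k < nth xs k + d →
  pos + k ∈ ascIdxFrom d pos prev xs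
ascIdxFrom-complete d pos prev (x ∷ xs) {k} k<l a with isAscStep d prev x | isAscStep-reflects d prev x
ascIdxFrom-complete d pos prev (x ∷ xs) {zero} _ a | true | _ = here (+-identityʳ pos)
ascIdxFrom-complete d pos prev (x ∷ xs) {zero} _ a | false | ofⁿ ¬asc = ⊥-elim (¬asc a)
ascIdxFrom-complete d pos prev (x ∷ xs) {suc k} (s≤s k<l) a | true | _
  rewrite +-suc pos k = there (ascIdxFrom-complete d (suc pos) x xs k<l a)
ascIdxFrom-complete d pos prev (x ∷ xs) {suc k} (s≤s k<l) a | false | _
  rewrite +-suc pos k = ascIdxFrom-complete d (suc pos) x xs k<l a

ascents-sorted : ∀ d w → AllPairs _<_ (ascents d w)
ascents-sorted d []       = []
ascents-sorted d (x ∷ xs) = ascIdxFrom-lowerBound d 1 x xs ∷ ascIdxFrom-sorted d 1 x xs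

∈-ascents⇔ : ∀ d w {j} → j ∈ ascents d w ⇔ (j < length w × IsAscentAt d w j)
∈-ascents⇔ d w = mk⇔ (sound w) (complete w)
  where
  sound : ∀ w {j} → j ∈ ascents d w → j < length w × IsAscentAt d w j
  sound (x ∷ xs) (here refl) = s≤s z≤n , tt
  sound (x ∷ xs) (there j∈) with ascIdxFrom-sound d 1 x xs j∈
  ... | k , refl , k<l , a = s≤s k<l , a

  complete : ∀ w {j} → j < length w × IsAscentAt d w j → j ∈ ascents d w
  complete (x ∷ xs) {zero}  _              = here refl
  complete (x ∷ xs) {suc k} (s≤s k<l , a) = there (ascIdxFrom-complete d 1 x xs k<l a)

hat-rise-fresh : ∀ d α k → suc k < length (hat d α) →
  nth (hat d α) k < nth (hat d α) (suc k) → IsFresh (hat d α) (suc k)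
hat-rise-fresh d α k k+1<l rise
  with subst (suc k <_) (length-foldl-M α (ascents d α)) k+1<l | nth α k <? nth α (suc k) + d
... | k+1<l′ | yes asc =
  foldl-M-fresh α (ascents d α) (ascents-sorted d α) (∈-ascents⇔ d α .from (k+1<l′ , asc)) k+1<l′
... | k+1<l′ | no ¬asc = ⊥-elim (<⇒≱ rise (foldl-M-preserves-descent α (ascents d α) k k+1<l′
  (¬asc ∘ proj₂ ∘ ∈-ascents⇔ d α .to) (m+n≤o⇒m≤o _ (≮⇒≥ ¬asc))))

-- Prefix maxima and prefix ascent counts

prefixMax : Word → ℕ → ℕ
prefixMax w i = maxW (take i w)

prefixAsc : ℕ → Word → ℕ → ℕ
prefixAsc d w i = asc d (take i w)

ascStep : ℕ → Word → ℕ → ℕ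
ascStep d w zero    = 1
ascStep d w (suc k) = if isAscStep d (nth w k) (nth w (suc k)) then 1 else 0

prefixMax-suc : ∀ w {i} → i < length w → prefixMax w (suc i) ≡ prefixMax w i ⊔ nth w i
prefixMax-suc (x ∷ xs) {zero}  _         = ⊔-identityʳ x
prefixMax-suc (x ∷ xs) {suc i} (s≤s i<l) =
  trans (cong (x ⊔_) (prefixMax-suc xs i<l)) (sym (⊔-assoc x (prefixMax xs i) (nth xs i)))

ascFrom-take-suc : ∀ d prev xs {i} → i < length xs →
  ascFrom d prev (take (suc i) xs) ≡ ascFrom d prev (take i xs) + ascStep d (prev ∷ xs) (suc i)
ascFrom-take-suc d prev (x ∷ xs) {zero}  _         = +-identityʳ _
ascFrom-take-suc d prev (x ∷ xs) {suc i} (s≤s i<l) =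
  trans (cong (step +_) (ascFrom-take-suc d x xs i<l)) (sym (+-assoc step _ _))
  where
  step : ℕ
  step = if isAscStep d prev x then 1 else 0

prefixAsc-suc : ∀ d w {i} → i < length w → prefixAsc d w (suc i) ≡ prefixAsc d w i + ascStep d w i
prefixAsc-suc d (x ∷ xs) {zero}  _         = refl
prefixAsc-suc d (x ∷ xs) {suc k} (s≤s k<l) = cong suc (ascFrom-take-suc d x xs k<l)

ascStep-ascent : ∀ d w k → IsAscentAt d w (suc k) → ascStep d w (suc k) ≡ 1
ascStep-ascent d w k a with isAscStep d (nth w k) (nth w (suc k)) | isAscStep-reflects d (nth w k) (nth w (suc k))
... | true  | _        = refl
... | false | ofⁿ ¬asc = ⊥-elim (¬asc a)

ascStep-nonAscent : ∀ d w k → ¬ IsAscentAt d w (suc k) → ascStep d w (suc k) ≡ 0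
ascStep-nonAscent d w k ¬a with isAscStep d (nth w k) (nth w (suc k)) | isAscStep-reflects d (nth w k) (nth w (suc k))
... | true  | ofʸ asc = ⊥-elim (¬a asc)
... | false | _       = refl

nth≤prefixMax : ∀ w {k i} → k < i → nth w k ≤ prefixMax w i
nth≤prefixMax []       _                 = z≤n
nth≤prefixMax (x ∷ xs) {zero}  {suc i} _ = m≤m⊔n x _
nth≤prefixMax (x ∷ xs) {suc k} {suc i} (s≤s k<i) = ≤-trans (nth≤prefixMax xs k<i) (m≤n⊔m x _)

prefixMax-< : ∀ w i {v} → 0 < v → (∀ {k} → k < i → nth w k < v) → prefixMax w i < v
prefixMax-< w        zero    0<v _     = 0<v
prefixMax-< []       (suc i) 0<v _     = 0<v
prefixMax-< (x ∷ xs) (suc i) 0<v below =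
  ⊔-lub (below (s≤s z≤n)) (prefixMax-< xs i 0<v (below ∘ s≤s))

records⇒prefixAsc≤prefixMax : ∀ d w → Positive w →
  (∀ {j} → j < length w → IsAscentAt d w j → IsRecord w j) →
  ∀ i → i ≤ length w → prefixAsc d w i ≤ prefixMax w i
records⇒prefixAsc≤prefixMax d w pos recs zero    _     = z≤n
records⇒prefixAsc≤prefixMax d w pos recs (suc i) i<l
  rewrite prefixAsc-suc d w i<l | prefixMax-suc w i<l = step i i<l (records⇒prefixAsc≤prefixMax d w pos recs i (<⇒≤ i<l))
  where
  step : ∀ i → i < length w → prefixAsc d w i ≤ prefixMax w i →
         prefixAsc d w i + ascStep d w i ≤ prefixMax w i ⊔ nth w i
  step zero    0<l _ = Positive-nth pos 0<l
  step (suc k) k+1<l ih with nth w k <? nth w (suc k) + d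
  ... | yes a rewrite ascStep-ascent d w k a | +-comm (prefixAsc d w (suc k)) 1 =
    ≤-trans (s≤s ih)
      (≤-trans (prefixMax-< w (suc k) (Positive-nth pos k+1<l) (recs k+1<l a)) (m≤n⊔m _ _))
  ... | no ¬a rewrite ascStep-nonAscent d w k ¬a | +-identityʳ (prefixAsc d w (suc k)) =
    ≤-trans ih (m≤m⊔n _ _)

-- Restricted growth functions

newMax⇒ascStep≡1 : ∀ d w i → i < length w → prefixMax w i < nth w i → ascStep d w i ≡ 1
newMax⇒ascStep≡1 d w zero    _ _   = refl
newMax⇒ascStep≡1 d w (suc k) _ new =
  ascStep-ascent d w k (≤-trans (≤-<-trans (nth≤prefixMax w (n<1+n k)) new) (m≤m+n _ d))

rgf⇒prefixMax≤prefixAsc : ∀ d w → Bounded w (suc ∘ prefixMax w) →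
  ∀ i → i ≤ length w → prefixMax w i ≤ prefixAsc d w i
rgf⇒prefixMax≤prefixAsc d w bounded zero    _   = z≤n
rgf⇒prefixMax≤prefixAsc d w bounded (suc i) i<l
  rewrite prefixAsc-suc d w i<l | prefixMax-suc w i<l =
  ⊔-lub (≤-trans ih (m≤m+n _ _)) new-letter
  where
  ih : prefixMax w i ≤ prefixAsc d w i
  ih = rgf⇒prefixMax≤prefixAsc d w bounded i (<⇒≤ i<l)
  new-letter : nth w i ≤ prefixAsc d w i + ascStep d w i
  new-letter with nth w i ≤? prefixMax w i
  ... | yes old = ≤-trans old (≤-trans ih (m≤m+n _ _))
  ... | no  new rewrite newMax⇒ascStep≡1 d w i i<l (≰⇒> new) | +-comm (prefixAsc d w i) 1 =
    ≤-trans (bounded i<l) (s≤s ih)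

rgf-occurs : ∀ w → Bounded w (suc ∘ prefixMax w) →
  ∀ i {v} → i ≤ length w → 1 ≤ v → v ≤ prefixMax w i → ∃[ k ] k < i × nth w k ≡ v
rgf-occurs w bounded zero    _   1≤v v≤0 = ⊥-elim (<⇒≱ 1≤v v≤0)
rgf-occurs w bounded (suc i) {v} i<l 1≤v v≤max with v ≤? prefixMax w i
... | yes v≤max′ with rgf-occurs w bounded i (<⇒≤ i<l) 1≤v v≤max′
...   | k , k<i , wk≡v = k , <-trans k<i (n<1+n i) , wk≡v
rgf-occurs w bounded (suc i) {v} i<l 1≤v v≤max | no v≰max′ =
  i , n<1+n i , ≤-antisym (≤-trans (bounded i<l) (≰⇒> v≰max′)) v≤wi
  where
  v≤wi : v ≤ nth w i
  v≤wi with ≤-total (prefixMax w i) (nth w i) | subst (v ≤_) (prefixMax-suc w i<l) v≤max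
  ... | inj₁ max≤wi | v≤⊔ = subst (v ≤_) (m≤n⇒m⊔n≡n max≤wi) v≤⊔
  ... | inj₂ wi≤max | v≤⊔ = ⊥-elim (v≰max′ (subst (v ≤_) (m≥n⇒m⊔n≡m wi≤max) v≤⊔))

rgf-fresh⇒record : ∀ w → Positive w → Bounded w (suc ∘ prefixMax w) →
  ∀ {j} → j < length w → IsFresh w j → IsRecord w j
rgf-fresh⇒record w pos bounded {j} j<l fresh i<j = ≤-<-trans (nth≤prefixMax w i<j) newMax
  where
  newMax : prefixMax w j < nth w j
  newMax with nth w j ≤? prefixMax w j
  ... | no  new = ≰⇒> new
  ... | yes old with rgf-occurs w bounded j (<⇒≤ j<l) (Positive-nth pos j<l) old
  ...   | k , k<j , wk≡wj = ⊥-elim (fresh k<j wk≡wj)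

-- From positions in Fin to positions in ℕ

lookup≡nth : ∀ w (i : Fin (length w)) → lookup w i ≡ nth w (toℕ i)
lookup≡nth (x ∷ w) Fin.zero    = refl
lookup≡nth (x ∷ w) (Fin.suc i) = lookup≡nth w i

lookup-bounded⇔Bounded : ∀ w f → ((i : Fin (length w)) → lookup w i ≤ f (toℕ i)) ⇔ Bounded w f
lookup-bounded⇔Bounded w f = mk⇔
  (λ bounded {i} i<l → subst₂ _≤_
    (trans (lookup≡nth w (fromℕ< i<l)) (cong (nth w) (toℕ-fromℕ< i<l)))
    (cong f (toℕ-fromℕ< i<l))
    (bounded (fromℕ< i<l)))
  (λ bounded i → subst (_≤ f (toℕ i)) (sym (lookup≡nth w i)) (bounded (toℕ<n i)))

IsAscSeq⇔ : ∀ d w → IsAscSeq d w ⇔ (Positive w × Bounded w (suc ∘ prefixAsc d w))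
IsAscSeq⇔ d w = mk⇔
  (λ (pos , bounded) → pos , lookup-bounded⇔Bounded w _ .to bounded)
  (λ (pos , bounded) → pos , lookup-bounded⇔Bounded w _ .from bounded)

-- The condition a₁ = 1 is the bound at position 0, since the empty prefix has maximum 0.
IsRGF⇔ : ∀ w → IsRGF w ⇔ (Positive w × Bounded w (suc ∘ prefixMax w))
IsRGF⇔ []       = mk⇔ (λ _ → [] , λ ()) (λ _ → tt)
IsRGF⇔ (x ∷ xs) = mk⇔
  (λ (pos , _ , bounded) → pos , lookup-bounded⇔Bounded (x ∷ xs) _ .to bounded)
  (λ (pos , bounded) → pos , ≤-antisym (bounded (s≤s z≤n)) (Positive-nth pos (s≤s z≤n))
                           , lookup-bounded⇔Bounded (x ∷ xs) _ .from bounded)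

Atilde0⇒Ihat×RGF : ∀ α → InAtilde0 α → InIhat α × IsRGF α
Atilde0⇒Ihat×RGF α (ascSeq , fixed) =
  (0 , α , ascSeq , fixed) ,
  IsRGF⇔ α .from (pos , λ i<l → ≤-trans (bounded i<l)
    (s≤s (records⇒prefixAsc≤prefixMax 0 α pos records _ (<⇒≤ i<l))))
  where
  pos : Positive α
  pos = proj₁ (IsAscSeq⇔ 0 α .to ascSeq)
  bounded : Bounded α (suc ∘ prefixAsc 0 α)
  bounded = proj₂ (IsAscSeq⇔ 0 α .to ascSeq)
  records : ∀ {j} → j < length α → IsAscentAt 0 α j → IsRecord α j
  records j<l a = foldl-M-fixed⇔records α (ascents 0 α) .to fixed (∈-ascents⇔ 0 α .from (j<l , a)) j<l

Ihat×RGF⇒Atilde0 : ∀ β → InIhat β × IsRGF β → InAtilde0 β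
Ihat×RGF⇒Atilde0 .(hat d α) ((d , α , _ , refl) , rgf) =
  IsAscSeq⇔ 0 β .from (pos , λ i<l → ≤-trans (bounded i<l) (s≤s (rgf⇒prefixMax≤prefixAsc 0 β bounded _ (<⇒≤ i<l)))) ,
  foldl-M-fixed⇔records β (ascents 0 β) .from λ j∈ j<l → ascent⇒record (proj₂ (∈-ascents⇔ 0 β .to j∈)) j<l
  where
  β : Word
  β = hat d α
  pos : Positive β
  pos = proj₁ (IsRGF⇔ β .to rgf)
  bounded : Bounded β (suc ∘ prefixMax β)
  bounded = proj₂ (IsRGF⇔ β .to rgf)
  ascent⇒record : ∀ {j} → IsAscentAt 0 β j → j < length β → IsRecord β j
  ascent⇒record {zero}  _    _     ()
  ascent⇒record {suc k} rise k+1<l = rgf-fresh⇒record β pos bounded k+1<l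
    (hat-rise-fresh d α k k+1<l (subst (nth β k <_) (+-identityʳ _) rise))

corollary3p9 : (α : Word) → InAtilde0 α ⇔ (InIhat α × IsRGF α)
corollary3p9 α = mk⇔ (Atilde0⇒Ihat×RGF α) (Ihat×RGF⇒Atilde0 α)
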